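{- Let $n$ be a positive integer. There exists an antipodal $3$-design with $n$ rational points for the Chebyshev measure $(1-t^2)^{ -1/2}dt/\pi$ on $(-1,1)$ if and only if $n\notin\{1,2,3,7\}$.
   Context: An $m$-design with $n$ points for a probability measure $w(t)dt$ on an interval $I$ is a set of $n$ pairwise distinct points $x_1,\dots,x_n\in I$ with $\frac1n\sum_i f(x_i)=\int_I f(t)w(t)dt$ for every real polynomial $f$ of degree at most $m$. It is rational if all $x_i\in\mathbb{Q}$ and antipodal if $\{x_i\}=\{ -x_i\}$. -}

module Defs where

open import Data.Nat as ℕ using (ℕ; zero; suc; _^_)
open import Data.Nat.Properties using (m^n≢0)
open import Data.Nat.Combinatorics using (_C_)
open import Data.Integer using (+_)
open import Data.Rational using (ℚ; 0ℚ; 1ℚ; _+_; _*_; -_; _<_; _/_)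
open import Data.Fin using (Fin; zero; suc)
open import Data.List using (List; []; _∷_; length)
open import Data.Product using (Σ; _×_; _,_)
open import Relation.Binary.PropositionalEquality using (_≡_)

sumFin : ∀ {n} → (Fin n → ℚ) → ℚ
sumFin {zero}  f = 0ℚ
sumFin {suc n} f = f zero + sumFin (λ i → f (suc i))

ℕtoℚ : ℕ → ℚ
ℕtoℚ n = (+ n) / 1

-- A polynomial a₀ + a₁ t + … + a_d t^d as its coefficient list [a₀, …, a_d].
Poly : Set
Poly = List ℚ

eval : Poly → ℚ → ℚ
eval []       t = 0ℚ
eval (a ∷ as) t = a + t * eval as t

DegLe : ℕ → Poly → Set
DegLe m p = length p ℕ.≤ suc m

-- Integral of a polynomial against a measure given by its moment sequence
-- μ k = ∫ t^k w(t) dt :  ∫ (Σ a_k t^k) w = Σ a_k μ k.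
integrate : (ℕ → ℚ) → Poly → ℚ
integrate μ []       = 0ℚ
integrate μ (a ∷ as) = a * μ 0 + integrate (λ k → μ (suc k)) as

-- Moments of the Chebyshev measure (1-t²)^(-1/2) dt / π on (-1,1):
-- ∫ t^(2j) = C(2j,j)/4^j ,  ∫ t^(2j+1) = 0.
chebyshevMoment : ℕ → ℚ
chebyshevMoment k = go k
  where
  evenMoment : ℕ → ℚ
  evenMoment j = _/_ (+ ((2 ℕ.* j) C j)) (4 ^ j) {{m^n≢0 4 j}}
  -- go r = moment of t^k, recursing on r to decide parity of k
  go : ℕ → ℚ
  go zero          = evenMoment (ℕ.⌊ k /2⌋)
  go (suc zero)    = 0ℚ
  go (suc (suc r)) = go r

IsDesign : (μ : ℕ → ℚ) (m n : ℕ) → (Fin n → ℚ) → Set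
IsDesign μ m n x =
    (∀ i j → x i ≡ x j → i ≡ j)
  × (∀ i → (- 1ℚ) < x i × x i < 1ℚ)
  × (∀ (f : Poly) → DegLe m f →
       sumFin (λ i → eval f (x i)) ≡ ℕtoℚ n * integrate μ f)

IsAntipodal : ∀ {n} → (Fin n → ℚ) → Set
IsAntipodal {n} x = ∀ i → Σ (Fin n) (λ j → x j ≡ - x i)

module Submission where

-- An antipodal set is {±y₁, …, ±yₖ}, possibly together with 0, so its odd power sums vanish
-- and it is a 3-design for the Chebyshev measure (moments 1, 0, 1/2, 0) exactly when
-- Σ x² = n/2, that is 4 Σ yᵢ² = n with k = ⌊n/2⌋.  For n = 1 this is absurd, for n = 2, 3
-- it makes 2 or 3 a rational square and for n = 7 it makes 7 a sum of three rational
-- squares; after clearing denominators both are excluded by infinite descent, because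
-- squares are 0 or 1 mod 4 and odd squares are 1 mod 8.  Every other n is 4k + s with
-- s ∈ {0, 5, 6, 11}: an explicit seed solves 4 Σ y² = s inside (8/17, 15/17), and k
-- Pythagorean pairs (2t, t² − 1)/(t² + 1), t = 4, 5, …, each add 4 to both sides; they
-- lie on nested intervals around the seed, so all points stay distinct.

open import Defs
open import Data.Bool using (Bool; true; false; if_then_else_)
open import Data.Empty using (⊥-elim)
open import Data.Fin using (Fin; zero; suc)
open import Data.List using (List; []; _∷_; _++_; length; lookup; tabulate)
open import Data.List.Membership.Propositional using (_∈_)
open import Data.List.Relation.Binary.Permutation.Propositional
  using (_↭_; refl; prep; swap; trans; ↭-sym; ↭-trans; ↭⇒↭ₛ)
open import Data.List.Relation.Unary.All as All using (All; []; _∷_)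
open import Data.List.Relation.Unary.Any using (here; there)
open import Data.List.Relation.Unary.Unique.Propositional using (Unique; []; _∷_)
open import Data.Nat as ℕ using (ℕ; zero; suc; NonZero; ⌊_/2⌋)
import Data.Nat.Properties as ℕP
import Data.Nat.Tactic.RingSolver as ℕ-Solver
open import Data.Product using (Σ; ∃; ∃₂; _×_; _,_; proj₁; proj₂; uncurry)
open import Data.Rational as ℚ using (ℚ; 0ℚ; 1ℚ; ½; toℚᵘ)
import Data.Rational.Properties as ℚP
open import Data.Sum using (_⊎_; inj₁; inj₂)
open import Function using (_∘_)
open import Function.Bundles using (_⇔_; mk⇔)
open import Level using (0ℓ)
open import Relation.Binary.PropositionalEquality as ≡
  using (_≡_; _≢_; refl; cong; cong₂; sym; subst; ≢-sym; module ≡-Reasoning)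
open import Relation.Nullary using (¬_; yes; no)
open import Relation.Nullary.Decidable using (dec⇒maybe)
open import Tactic.RingSolver using (solve-∀)
open import Tactic.RingSolver.Core.AlmostCommutativeRing using (AlmostCommutativeRing; fromCommutativeRing)

ℚ-ring : AlmostCommutativeRing 0ℓ 0ℓ
ℚ-ring = fromCommutativeRing ℚP.+-*-commutativeRing (λ x → dec⇒maybe (0ℚ ℚ.≟ x))

-- Powers are taken from the solver's ring so that `solve-∀ ℚ-ring` normalises them.
open AlmostCommutativeRing ℚ-ring using (_^_)
open import Algebra.Properties.Semiring.Exp.TCOptimised (AlmostCommutativeRing.semiring ℚ-ring) using (^-homo-*)

^-suc : ∀ x k → x ^ suc k ≡ x ℚ.* x ^ k
^-suc x k = ^-homo-* x 1 k


module Fractions where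

  open import Data.Integer as ℤ using (+_)
  import Data.Integer.Properties as ℤP
  import Data.Integer.Tactic.RingSolver as ℤ-Solver
  open import Data.Rational using (_+_; _*_; _<_; _/_)
  open import Data.Rational.Unnormalised as ℚᵘ using (mkℚᵘ; *≡*; *<*)
  import Data.Rational.Unnormalised.Properties as ℚᵘP

  toℚᵘ-/ : ∀ a d → toℚᵘ (+ a / suc d) ℚᵘ.≃ mkℚᵘ (+ a) d
  toℚᵘ-/ a d = ℚP.toℚᵘ-fromℚᵘ (mkℚᵘ (+ a) d)

  ℕtoℚ-+ : ∀ m n → ℕtoℚ (m ℕ.+ n) ≡ ℕtoℚ m + ℕtoℚ n
  ℕtoℚ-+ m n = ℚP.toℚᵘ-injective (begin
    toℚᵘ (ℕtoℚ (m ℕ.+ n))              ≈⟨ toℚᵘ-/ (m ℕ.+ n) 0 ⟩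
    mkℚᵘ (+ m ℤ.+ + n) 0                ≈⟨ *≡* (split (+ m) (+ n)) ⟩
    mkℚᵘ (+ m) 0 ℚᵘ.+ mkℚᵘ (+ n) 0      ≈⟨ ℚᵘP.+-cong (toℚᵘ-/ m 0) (toℚᵘ-/ n 0) ⟨
    toℚᵘ (ℕtoℚ m) ℚᵘ.+ toℚᵘ (ℕtoℚ n)    ≈⟨ ℚP.toℚᵘ-homo-+ (ℕtoℚ m) (ℕtoℚ n) ⟨
    toℚᵘ (ℕtoℚ m + ℕtoℚ n)              ∎)
    where
    open ℚᵘP.≃-Reasoning
    split : ∀ x y → (x ℤ.+ y) ℤ.* + 1 ≡ (x ℤ.* + 1 ℤ.+ y ℤ.* + 1) ℤ.* + 1
    split = ℤ-Solver.solve-∀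

  /-<-/ : ∀ a d b e → a ℕ.* suc e ℕ.< b ℕ.* suc d → + a / suc d < + b / suc e
  /-<-/ a d b e lt = ℚP.toℚᵘ-cancel-<
    (ℚᵘP.<-respˡ-≃ (ℚᵘP.≃-sym (toℚᵘ-/ a d)) (ℚᵘP.<-respʳ-≃ (ℚᵘP.≃-sym (toℚᵘ-/ b e))
      (*<* (≡.subst₂ ℤ._<_ (ℤP.pos-* a (suc e)) (ℤP.pos-* b (suc d)) (ℤ.+<+ lt)))))

  /-pythagorean : ∀ a b d → a ℕ.* a ℕ.+ b ℕ.* b ≡ suc d ℕ.* suc d →
                  (+ a / suc d) ^ 2 + (+ b / suc d) ^ 2 ≡ 1ℚ
  /-pythagorean a b d a²+b²≡d² = ℚP.toℚᵘ-injective (let open ℚᵘP.≃-Reasoning in begin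
    toℚᵘ (x * x + y * y)                      ≈⟨ ℚP.toℚᵘ-homo-+ (x * x) (y * y) ⟩
    toℚᵘ (x * x) ℚᵘ.+ toℚᵘ (y * y)
      ≈⟨ ℚᵘP.+-cong (ℚP.toℚᵘ-homo-* x x) (ℚP.toℚᵘ-homo-* y y) ⟩
    toℚᵘ x ℚᵘ.* toℚᵘ x ℚᵘ.+ toℚᵘ y ℚᵘ.* toℚᵘ y
      ≈⟨ ℚᵘP.+-cong (ℚᵘP.*-cong (toℚᵘ-/ a d) (toℚᵘ-/ a d))
                    (ℚᵘP.*-cong (toℚᵘ-/ b d) (toℚᵘ-/ b d)) ⟩
    mkℚᵘ (+ a) d ℚᵘ.* mkℚᵘ (+ a) d ℚᵘ.+ mkℚᵘ (+ b) d ℚᵘ.* mkℚᵘ (+ b) d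
                                              ≈⟨ *≡* cross ⟩
    ℚᵘ.1ℚᵘ                                    ∎)
    where
    x = + a / suc d
    y = + b / suc d
    D = suc d
    A = + a
    B = + b
    E = + D
    square : ∀ n → + (n ℕ.* n) ≡ + n ℤ.* + n
    square n = ℤP.pos-* n n
    a²+b²≡d²ℤ : A ℤ.* A ℤ.+ B ℤ.* B ≡ E ℤ.* E
    a²+b²≡d²ℤ = ≡.trans (sym (cong₂ ℤ._+_ (square a) (square b))) (≡.trans (cong +_ a²+b²≡d²) (square D))
    factor : ∀ p q r → (p ℤ.* p ℤ.* r ℤ.+ q ℤ.* q ℤ.* r) ℤ.* + 1 ≡ (p ℤ.* p ℤ.+ q ℤ.* q) ℤ.* r
    factor = ℤ-Solver.solve-∀
    unit : ∀ r → r ℤ.* r ≡ + 1 ℤ.* (r ℤ.* r)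
    unit = ℤ-Solver.solve-∀
    cross : (A ℤ.* A ℤ.* + (D ℕ.* D) ℤ.+ B ℤ.* B ℤ.* + (D ℕ.* D)) ℤ.* + 1
          ≡ + 1 ℤ.* + (D ℕ.* D ℕ.* (D ℕ.* D))
    cross = begin
      (A ℤ.* A ℤ.* + (D ℕ.* D) ℤ.+ B ℤ.* B ℤ.* + (D ℕ.* D)) ℤ.* + 1
        ≡⟨ cong (λ r → (A ℤ.* A ℤ.* r ℤ.+ B ℤ.* B ℤ.* r) ℤ.* + 1) (square D) ⟩
      (A ℤ.* A ℤ.* (E ℤ.* E) ℤ.+ B ℤ.* B ℤ.* (E ℤ.* E)) ℤ.* + 1  ≡⟨ factor A B (E ℤ.* E) ⟩
      (A ℤ.* A ℤ.+ B ℤ.* B) ℤ.* (E ℤ.* E)                        ≡⟨ cong (ℤ._* (E ℤ.* E)) a²+b²≡d²ℤ ⟩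
      E ℤ.* E ℤ.* (E ℤ.* E)                                      ≡⟨ unit (E ℤ.* E) ⟩
      + 1 ℤ.* (E ℤ.* E ℤ.* (E ℤ.* E))
        ≡⟨ cong (λ r → + 1 ℤ.* (r ℤ.* r)) (square D) ⟨
      + 1 ℤ.* (+ (D ℕ.* D) ℤ.* + (D ℕ.* D))                      ≡⟨ cong (+ 1 ℤ.*_) (square (D ℕ.* D)) ⟨
      + 1 ℤ.* + (D ℕ.* D ℕ.* (D ℕ.* D))                          ∎
      where open ≡-Reasoning

open Fractions


module Moments where

  open import Data.List.Properties using (tabulate-lookup)
  open import Data.Rational using (_+_; _*_)

  sumOver : (ℚ → ℚ) → List ℚ → ℚ
  sumOver g []       = 0ℚ
  sumOver g (v ∷ vs) = g v + sumOver g vs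

  powerSum : List ℚ → ℕ → ℚ
  powerSum L k = sumOver (_^ k) L

  sumOver-cong : ∀ {g h} → (∀ y → g y ≡ h y) → ∀ L → sumOver g L ≡ sumOver h L
  sumOver-cong g≗h []      = refl
  sumOver-cong g≗h (y ∷ L) = cong₂ _+_ (g≗h y) (sumOver-cong g≗h L)

  sumOver-0 : ∀ L → sumOver (λ _ → 0ℚ) L ≡ 0ℚ
  sumOver-0 []      = refl
  sumOver-0 (y ∷ L) = cong (0ℚ +_) (sumOver-0 L)

  sumOver-+ : ∀ g h L → sumOver (λ y → g y + h y) L ≡ sumOver g L + sumOver h L
  sumOver-+ g h []      = refl
  sumOver-+ g h (y ∷ L) = ≡.trans (cong (g y + h y +_) (sumOver-+ g h L)) (interchange (g y) (h y) _ _)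
    where
    interchange : ∀ a b s t → a + b + (s + t) ≡ a + s + (b + t)
    interchange = solve-∀ ℚ-ring

  sumOver-↭ : ∀ g {L L′} → L ↭ L′ → sumOver g L ≡ sumOver g L′
  sumOver-↭ g refl         = refl
  sumOver-↭ g (prep v p)   = cong (g v +_) (sumOver-↭ g p)
  sumOver-↭ g (swap v w p) = ≡.trans (cong (λ s → g v + (g w + s)) (sumOver-↭ g p)) (exchange (g v) (g w) _)
    where
    exchange : ∀ a b s → a + (b + s) ≡ b + (a + s)
    exchange = solve-∀ ℚ-ring
  sumOver-↭ g (trans p q)  = ≡.trans (sumOver-↭ g p) (sumOver-↭ g q)

  sumFin-tabulate : ∀ {n} g (x : Fin n → ℚ) → sumFin (λ i → g (x i)) ≡ sumOver g (tabulate x)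
  sumFin-tabulate {zero}  g x = refl
  sumFin-tabulate {suc n} g x = cong (g (x zero) +_) (sumFin-tabulate g (x ∘ suc))

  sumFin-lookup : ∀ g L → sumFin (λ i → g (lookup L i)) ≡ sumOver g L
  sumFin-lookup g L = ≡.trans (sumFin-tabulate g (lookup L)) (cong (sumOver g) (tabulate-lookup L))

  powerSum-length : ∀ L → powerSum L 0 ≡ ℕtoℚ (length L)
  powerSum-length []      = refl
  powerSum-length (v ∷ L) = ≡.trans (cong (1ℚ +_) (powerSum-length L)) (sym (ℕtoℚ-+ 1 (length L)))

  integrate-cong : ∀ {μ ν} f → (∀ {k} → k ℕ.< length f → μ k ≡ ν k) → integrate μ f ≡ integrate ν f
  integrate-cong []      _     = refl
  integrate-cong (a ∷ f) μ≗ν = cong₂ (λ m i → a * m + i) (μ≗ν ℕ.z<s) (integrate-cong f (μ≗ν ∘ ℕ.s<s))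

  integrate-0 : ∀ f → integrate (λ _ → 0ℚ) f ≡ 0ℚ
  integrate-0 []      = refl
  integrate-0 (a ∷ f) = ≡.trans (cong (a * 0ℚ +_) (integrate-0 f)) (vanish a)
    where
    vanish : ∀ a → a * 0ℚ + 0ℚ ≡ 0ℚ
    vanish = solve-∀ ℚ-ring

  integrate-+ : ∀ μ ν f → integrate (λ k → μ k + ν k) f ≡ integrate μ f + integrate ν f
  integrate-+ μ ν []      = refl
  integrate-+ μ ν (a ∷ f) =
    ≡.trans (cong (a * (μ 0 + ν 0) +_) (integrate-+ (μ ∘ suc) (ν ∘ suc) f)) (regroup a (μ 0) (ν 0) _ _)
    where
    regroup : ∀ a m n i j → a * (m + n) + (i + j) ≡ a * m + i + (a * n + j)
    regroup = solve-∀ ℚ-ring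

  integrate-*ˡ : ∀ c μ f → integrate (λ k → c * μ k) f ≡ c * integrate μ f
  integrate-*ˡ c μ []      = sym (ℚP.*-zeroʳ c)
  integrate-*ˡ c μ (a ∷ f) =
    ≡.trans (cong (a * (c * μ 0) +_) (integrate-*ˡ c (μ ∘ suc) f)) (regroup a c (μ 0) _)
    where
    regroup : ∀ a c m i → a * (c * m) + c * i ≡ c * (a * m + i)
    regroup = solve-∀ ℚ-ring

  integrate-powers : ∀ v f → integrate (v ^_) f ≡ eval f v
  integrate-powers v []      = refl
  integrate-powers v (a ∷ f) = begin
    a * 1ℚ + integrate (λ k → v ^ suc k) f  ≡⟨ cong (a * 1ℚ +_) (integrate-cong f (λ {k} _ → ^-suc v k)) ⟩
    a * 1ℚ + integrate (λ k → v * v ^ k) f  ≡⟨ cong (a * 1ℚ +_) (integrate-*ˡ v (v ^_) f) ⟩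
    a * 1ℚ + v * integrate (v ^_) f         ≡⟨ cong (λ e → a * 1ℚ + v * e) (integrate-powers v f) ⟩
    a * 1ℚ + v * eval f v                   ≡⟨ cong (_+ v * eval f v) (ℚP.*-identityʳ a) ⟩
    a + v * eval f v                        ∎
    where open ≡-Reasoning

  monomial : ℕ → Poly
  monomial zero    = 1ℚ ∷ []
  monomial (suc k) = 0ℚ ∷ monomial k

  length-monomial : ∀ k → length (monomial k) ≡ suc k
  length-monomial zero    = refl
  length-monomial (suc k) = cong suc (length-monomial k)

  integrate-monomial : ∀ μ k → integrate μ (monomial k) ≡ μ k
  integrate-monomial μ zero    = unit (μ 0)
    where
    unit : ∀ m → 1ℚ * m + 0ℚ ≡ m
    unit = solve-∀ ℚ-ring
  integrate-monomial μ (suc k) = ≡.trans (cong (0ℚ * μ 0 +_) (integrate-monomial (μ ∘ suc) k)) (drop (μ 0) _)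
    where
    drop : ∀ m i → 0ℚ * m + i ≡ i
    drop = solve-∀ ℚ-ring

  sumOver-eval : ∀ L f → sumOver (eval f) L ≡ integrate (powerSum L) f
  sumOver-eval []      f = sym (integrate-0 f)
  sumOver-eval (v ∷ L) f = ≡.trans (cong₂ _+_ (sym (integrate-powers v f)) (sumOver-eval L f))
                                   (sym (integrate-+ (v ^_) (powerSum L) f))

  DesignEquations : (μ : ℕ → ℚ) (m : ℕ) (N : ℚ) → List ℚ → Set
  DesignEquations μ m N L = ∀ f → DegLe m f → sumOver (eval f) L ≡ N * integrate μ f

  powerSums⇒designEquations : ∀ {μ m N} L → (∀ {k} → k ℕ.≤ m → powerSum L k ≡ N * μ k) →
                              DesignEquations μ m N L
  powerSums⇒designEquations {μ} {m} {N} L moments f deg = begin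
    sumOver (eval f) L           ≡⟨ sumOver-eval L f ⟩
    integrate (powerSum L) f     ≡⟨ integrate-cong f (λ k<n → moments (ℕ.s≤s⁻¹ (ℕP.≤-trans k<n deg))) ⟩
    integrate (λ k → N * μ k) f  ≡⟨ integrate-*ˡ N μ f ⟩
    N * integrate μ f            ∎
    where open ≡-Reasoning

  designEquations⇒powerSums : ∀ {μ m N} L → DesignEquations μ m N L →
                              ∀ {k} → k ℕ.≤ m → powerSum L k ≡ N * μ k
  designEquations⇒powerSums {μ} {m} {N} L design {k} k≤m = begin
    powerSum L k                         ≡⟨ integrate-monomial (powerSum L) k ⟨
    integrate (powerSum L) (monomial k)  ≡⟨ sumOver-eval L (monomial k) ⟨
    sumOver (eval (monomial k)) L
      ≡⟨ design (monomial k) (ℕP.≤-trans (ℕP.≤-reflexive (length-monomial k)) (ℕ.s≤s k≤m)) ⟩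
    N * integrate μ (monomial k)         ≡⟨ cong (N *_) (integrate-monomial μ k) ⟩
    N * μ k                              ∎
    where open ≡-Reasoning

open Moments


module AntipodalSets where

  open import Data.List.Membership.Propositional.Properties using (∈-∃++)
  open import Data.List.Relation.Binary.Permutation.Propositional.Properties using (∈-resp-↭; ↭-length; shift)
  import Data.List.Relation.Binary.Permutation.Setoid.Properties as Permutationₛ
  open import Data.Nat.Induction using (<-wellFounded)
  open import Data.Rational using (_+_; _*_; -_; _<_)
  open import Induction.WellFounded using (Acc; acc)

  neg-involutive : ∀ y → - (- y) ≡ y
  neg-involutive = solve-∀ ℚ-ring

  -w≡v⇒w≡-v : ∀ {v w} → - w ≡ v → w ≡ - v
  -w≡v⇒w≡-v {v} {w} -w≡v = ≡.trans (sym (neg-involutive w)) (cong -_ -w≡v)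

  -v≡v⇒v≡0 : ∀ {v} → - v ≡ v → v ≡ 0ℚ
  -v≡v⇒v≡0 {v} -v≡v = begin
    v              ≡⟨ halve v ⟩
    (v + v) * ½    ≡⟨ cong (λ u → (u + v) * ½) -v≡v ⟨
    (- v + v) * ½  ≡⟨ cancel v ⟩
    0ℚ             ∎
    where
    open ≡-Reasoning
    halve : ∀ v → v ≡ (v + v) * ½
    halve = solve-∀ ℚ-ring
    cancel : ∀ v → (- v + v) * ½ ≡ 0ℚ
    cancel = solve-∀ ℚ-ring

  -<+ : ∀ {x y} → 0ℚ < x → 0ℚ < y → - x < y
  -<+ x>0 y>0 = ℚP.<-trans (ℚP.neg-antimono-< x>0) y>0

  antipodalSet : Bool → List ℚ → List ℚ
  antipodalSet withOrigin []      = if withOrigin then 0ℚ ∷ [] else []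
  antipodalSet withOrigin (y ∷ P) = y ∷ - y ∷ antipodalSet withOrigin P

  Antipodal : List ℚ → Set
  Antipodal L = ∀ {v} → v ∈ L → - v ∈ L

  antipodalSet-antipodal : ∀ b P → Antipodal (antipodalSet b P)
  antipodalSet-antipodal true  []      (here refl)         = here refl
  antipodalSet-antipodal b     (y ∷ P) (here refl)         = there (here refl)
  antipodalSet-antipodal b     (y ∷ P) (there (here refl)) = here (neg-involutive y)
  antipodalSet-antipodal b     (y ∷ P) (there (there v∈))  = there (there (antipodalSet-antipodal b P v∈))

  All-antipodalSet : ∀ {Q : ℚ → Set} b {P} → Q 0ℚ → All Q P → All (Q ∘ -_) P → All Q (antipodalSet b P)
  All-antipodalSet false q₀ []         []           = []
  All-antipodalSet true  q₀ []         []           = q₀ ∷ []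
  All-antipodalSet b     q₀ (qy ∷ qP) (q-y ∷ q-P) = qy ∷ q-y ∷ All-antipodalSet b q₀ qP q-P

  antipodalSet-unique : ∀ b {P} → All (0ℚ <_) P → Unique P → Unique (antipodalSet b P)
  antipodalSet-unique false []            []            = []
  antipodalSet-unique true  []            []            = [] ∷ []
  antipodalSet-unique b {y ∷ P} (y>0 ∷ P>0) (y∉P ∷ uniqueP) =
      (≢-sym (ℚP.<⇒≢ (-<+ y>0 y>0)) ∷ All-antipodalSet b (≢-sym (ℚP.<⇒≢ y>0)) y∉P (All.map y≢-w P>0))
    ∷ All-antipodalSet b (ℚP.<⇒≢ (ℚP.neg-antimono-< y>0))
        (All.map (ℚP.<⇒≢ ∘ -<+ y>0) P>0) (All.map -y≢-w y∉P)
    ∷ antipodalSet-unique b P>0 uniqueP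
    where
    y≢-w : ∀ {w} → 0ℚ < w → y ≢ - w
    y≢-w w>0 = ≢-sym (ℚP.<⇒≢ (-<+ w>0 y>0))
    -y≢-w : ∀ {w} → y ≢ w → - y ≢ - w
    -y≢-w y≢w = y≢w ∘ ℚP.neg-injective

  0∈antipodalSet : ∀ P → 0ℚ ∈ antipodalSet true P
  0∈antipodalSet []      = here refl
  0∈antipodalSet (y ∷ P) = there (there (0∈antipodalSet P))

  ⌊length/2⌋-antipodalSet : ∀ b P → ⌊ length (antipodalSet b P) /2⌋ ≡ length P
  ⌊length/2⌋-antipodalSet false []      = refl
  ⌊length/2⌋-antipodalSet true  []      = refl
  ⌊length/2⌋-antipodalSet b     (y ∷ P) = cong suc (⌊length/2⌋-antipodalSet b P)

  sumOver-antipodalSet : ∀ {g} → g 0ℚ ≡ 0ℚ → ∀ b P →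
                         sumOver g (antipodalSet b P) ≡ sumOver (λ y → g y + g (- y)) P
  sumOver-antipodalSet g0≡0 false []      = refl
  sumOver-antipodalSet g0≡0 true  []      = cong (_+ 0ℚ) g0≡0
  sumOver-antipodalSet {g} g0≡0 b (y ∷ P) =
    ≡.trans (cong (λ s → g y + (g (- y) + s)) (sumOver-antipodalSet g0≡0 b P)) (assoc (g y) (g (- y)) _)
    where
    assoc : ∀ a c s → a + (c + s) ≡ a + c + s
    assoc = solve-∀ ℚ-ring

  0^suc : ∀ k → 0ℚ ^ suc k ≡ 0ℚ
  0^suc k = ≡.trans (^-suc 0ℚ k) (ℚP.*-zeroˡ (0ℚ ^ k))

  powerSum-antipodalSet-odd : ∀ k → (∀ y → y ^ suc k + (- y) ^ suc k ≡ 0ℚ) →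
                              ∀ b P → powerSum (antipodalSet b P) (suc k) ≡ 0ℚ
  powerSum-antipodalSet-odd k odd b P =
    ≡.trans (sumOver-antipodalSet (0^suc k) b P) (≡.trans (sumOver-cong odd P) (sumOver-0 P))

  powerSum-antipodalSet-2 : ∀ b P → powerSum (antipodalSet b P) 2 ≡ powerSum P 2 + powerSum P 2
  powerSum-antipodalSet-2 b P =
    ≡.trans (sumOver-antipodalSet (0^suc 1) b P) (≡.trans (sumOver-cong even P) (sumOver-+ (_^ 2) (_^ 2) P))
    where
    even : ∀ y → y ^ 2 + (- y) ^ 2 ≡ y ^ 2 + y ^ 2
    even = solve-∀ ℚ-ring

  Decomposition : List ℚ → Set
  Decomposition L = ∃₂ λ b P → L ↭ antipodalSet b P

  unique-↭ : ∀ {L L′} → L ↭ L′ → Unique L → Unique L′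
  unique-↭ L↭L′ = Permutationₛ.Unique-resp-↭ (≡.setoid ℚ) (↭⇒↭ₛ L↭L′)

  ∈⇒↭∷ : ∀ {v L} → v ∈ L → ∃ λ (R : List ℚ) → L ↭ v ∷ R
  ∈⇒↭∷ {v} v∈L with A , B , refl ← ∈-∃++ v∈L = A ++ B , shift v A B

  antipodalSet-origin-↭ : ∀ P → 0ℚ ∷ antipodalSet false P ↭ antipodalSet true P
  antipodalSet-origin-↭ []      = refl
  antipodalSet-origin-↭ (y ∷ P) = ↭-trans (↭-sym (shift 0ℚ (y ∷ - y ∷ []) (antipodalSet false P)))
                                          (prep y (prep (- y) (antipodalSet-origin-↭ P)))

  Antipodal-partner : ∀ {v L} → v ≢ 0ℚ → Antipodal (v ∷ L) → - v ∈ L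
  Antipodal-partner v≢0 closed with closed (here refl)
  ... | here -v≡v  = ⊥-elim (v≢0 (-v≡v⇒v≡0 -v≡v))
  ... | there -v∈L = -v∈L

  Antipodal-dropOrigin : ∀ {L} → All (0ℚ ≢_) L → Antipodal (0ℚ ∷ L) → Antipodal L
  Antipodal-dropOrigin 0∉L closed w∈L with closed (there w∈L)
  ... | here -w≡0  = ⊥-elim (All.lookup 0∉L w∈L (sym (-w≡v⇒w≡-v -w≡0)))
  ... | there -w∈L = -w∈L

  Antipodal-dropPair : ∀ {v L R} → All (v ≢_) L → All (- v ≢_) R → L ↭ - v ∷ R →
                       Antipodal (v ∷ L) → Antipodal R
  Antipodal-dropPair v∉L -v∉R L↭ closed w∈R with closed (there (∈-resp-↭ (↭-sym L↭) (there w∈R)))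
  ... | here -w≡v  = ⊥-elim (All.lookup -v∉R w∈R (sym (-w≡v⇒w≡-v -w≡v)))
  ... | there -w∈L with ∈-resp-↭ L↭ -w∈L
  ...   | here -w≡-v =
    ⊥-elim (All.lookup v∉L (∈-resp-↭ (↭-sym L↭) (there w∈R)) (sym (ℚP.neg-injective -w≡-v)))
  ...   | there -w∈R = -w∈R

  Decomposition-origin : ∀ {L} → All (0ℚ ≢_) L → Decomposition L → Decomposition (0ℚ ∷ L)
  Decomposition-origin 0∉L (false , P , L↭) = true , P , ↭-trans (prep 0ℚ L↭) (antipodalSet-origin-↭ P)
  Decomposition-origin 0∉L (true  , P , L↭) =
    ⊥-elim (All.lookup 0∉L (∈-resp-↭ (↭-sym L↭) (0∈antipodalSet P)) refl)

  Decomposition-pair : ∀ {v L R} → L ↭ - v ∷ R → Decomposition R → Decomposition (v ∷ L)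
  Decomposition-pair {v} L↭ (b , P , R↭) = b , v ∷ P , prep v (↭-trans L↭ (prep (- v) R↭))

  antipodal-decomposition : ∀ L → Unique L → Antipodal L → Decomposition L
  antipodal-decomposition L = go L (<-wellFounded (length L))
    where
    go : ∀ L → Acc ℕ._<_ (length L) → Unique L → Antipodal L → Decomposition L
    go []      _         _              _      = false , [] , refl
    go (v ∷ L) (acc rec) (v∉L ∷ uniqueL) closed with v ℚ.≟ 0ℚ
    ... | yes refl = Decomposition-origin v∉L (go L (rec (ℕP.n<1+n _)) uniqueL (Antipodal-dropOrigin v∉L closed))
    ... | no v≢0
      with R , L↭ ← ∈⇒↭∷ (Antipodal-partner v≢0 closed)
      with -v∉R ∷ uniqueR ← unique-↭ L↭ uniqueL
      = Decomposition-pair L↭ (go R (rec shorter) uniqueR (Antipodal-dropPair v∉L -v∉R L↭ closed))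
      where
      shorter : length R ℕ.< suc (length L)
      shorter = ℕ.s≤s (ℕP.≤-trans (ℕP.n≤1+n _) (ℕP.≤-reflexive (sym (↭-length L↭))))

open AntipodalSets


module ChebyshevDesigns where

  open import Data.List.Properties using (length-tabulate)
  open import Data.List.Membership.Propositional.Properties using (∈-lookup; ∈-tabulate⁺; ∈-tabulate⁻)
  open import Data.List.Relation.Binary.Permutation.Propositional.Properties using (↭-length)
  open import Data.List.Relation.Unary.Any using (index)
  open import Data.List.Relation.Unary.Any.Properties using (lookup-index)
  open import Data.List.Relation.Unary.Unique.Propositional.Properties using (tabulate⁺)
  open import Data.Rational using (_+_; _*_; -_; _<_)

  lookup-injective : ∀ {L : List ℚ} → Unique L → ∀ i j → lookup L i ≡ lookup L j → i ≡ j
  lookup-injective (_ ∷ _)         zero    zero    _  = refl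
  lookup-injective (v∉L ∷ _)       zero    (suc j) eq = ⊥-elim (All.lookup v∉L (∈-lookup j) eq)
  lookup-injective (v∉L ∷ _)       (suc i) zero    eq = ⊥-elim (All.lookup v∉L (∈-lookup i) (sym eq))
  lookup-injective (_ ∷ uniqueL)   (suc i) (suc j) eq = cong suc (lookup-injective uniqueL i j eq)

  AntipodalDesign : (μ : ℕ → ℚ) (m n : ℕ) → Set
  AntipodalDesign μ m n = Σ (Fin n → ℚ) λ x → IsDesign μ m n x × IsAntipodal x

  list⇒antipodalDesign : ∀ {μ m} L → Unique L → All (λ v → - 1ℚ < v × v < 1ℚ) L → Antipodal L →
                         DesignEquations μ m (ℕtoℚ (length L)) L → AntipodalDesign μ m (length L)
  list⇒antipodalDesign {μ} {m} L uniqueL inside closed equations =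
    lookup L , (lookup-injective uniqueL , All.lookup inside ∘ ∈-lookup , exact) , antipodal
    where
    exact : ∀ f → DegLe m f → sumFin (λ i → eval f (lookup L i)) ≡ ℕtoℚ (length L) * integrate μ f
    exact f deg = ≡.trans (sumFin-lookup (eval f) L) (equations f deg)
    antipodal : IsAntipodal (lookup L)
    antipodal i = index (closed (∈-lookup i)) , sym (lookup-index (closed (∈-lookup i)))

  antipodalDesign⇒list : ∀ {μ m n} → AntipodalDesign μ m n → Σ (List ℚ) λ L →
                         length L ≡ n × Unique L × Antipodal L × DesignEquations μ m (ℕtoℚ n) L
  antipodalDesign⇒list {μ} {m} {n} (x , (injective , _ , exact) , antipodal) =
    tabulate x , length-tabulate x , tabulate⁺ (injective _ _) , closed , equations
    where
    closed : Antipodal (tabulate x)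
    closed v∈ with i , refl ← ∈-tabulate⁻ v∈ with j , xj≡-xi ← antipodal i =
      subst (_∈ tabulate x) xj≡-xi (∈-tabulate⁺ j)
    equations : DesignEquations μ m (ℕtoℚ n) (tabulate x)
    equations f deg = ≡.trans (sym (sumFin-tabulate (eval f) x)) (exact f deg)

  4*S≡N⇒S+S≡N*½ : ∀ S N → ℕtoℚ 4 * S ≡ N → S + S ≡ N * ½
  4*S≡N⇒S+S≡N*½ S N 4S≡N = ≡.trans (regroup S) (cong (_* ½) 4S≡N)
    where
    regroup : ∀ S → S + S ≡ ℕtoℚ 4 * S * ½
    regroup = solve-∀ ℚ-ring

  S+S≡N*½⇒4*S≡N : ∀ S N → S + S ≡ N * ½ → ℕtoℚ 4 * S ≡ N
  S+S≡N*½⇒4*S≡N S N 2S≡N/2 = ≡.trans (regroup S) (≡.trans (cong (λ T → T + T) 2S≡N/2) (halves N))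
    where
    regroup : ∀ S → ℕtoℚ 4 * S ≡ S + S + (S + S)
    regroup = solve-∀ ℚ-ring
    halves : ∀ N → N * ½ + N * ½ ≡ N
    halves = solve-∀ ℚ-ring

  -- The positive points y of antipodalSet withOrigin points, inside (lo, hi); for this set
  -- the degree-2 design equation Σ x² = n · ½ reads 4 Σ y² = n.
  record PositiveHalf (lo hi : ℚ) (n : ℕ) : Set where
    field
      withOrigin : Bool
      points     : List ℚ
      unique     : Unique points
      inside     : All (λ y → lo < y × y < hi) points
      size       : length (antipodalSet withOrigin points) ≡ n
      squares    : ℕtoℚ 4 * powerSum points 2 ≡ ℕtoℚ n

  positiveHalf⇒antipodalDesign : ∀ {n} → PositiveHalf 0ℚ 1ℚ n → AntipodalDesign chebyshevMoment 3 n
  positiveHalf⇒antipodalDesign h = subst (AntipodalDesign chebyshevMoment 3) size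
    (list⇒antipodalDesign L (antipodalSet-unique withOrigin (All.map proj₁ inside) unique)
       (All-antipodalSet withOrigin (ℚP.neg-antimono-< 0<1 , 0<1) (All.map inside⁺ inside) (All.map inside⁻ inside))
       (antipodalSet-antipodal withOrigin points)
       (powerSums⇒designEquations {chebyshevMoment} {3} {N} L moments))
    where
    open PositiveHalf h
    L = antipodalSet withOrigin points
    N = ℕtoℚ (length L)
    0<1 : 0ℚ < 1ℚ
    0<1 = ℚP.positive⁻¹ 1ℚ
    inside⁺ : ∀ {y} → 0ℚ < y × y < 1ℚ → - 1ℚ < y × y < 1ℚ
    inside⁺ (y>0 , y<1) = ℚP.<-trans (ℚP.neg-antimono-< 0<1) y>0 , y<1
    inside⁻ : ∀ {y} → 0ℚ < y × y < 1ℚ → - 1ℚ < - y × - y < 1ℚ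
    inside⁻ (y>0 , y<1) = ℚP.neg-antimono-< y<1 , ℚP.<-trans (ℚP.neg-antimono-< y>0) 0<1
    odd₁ : ∀ y → y ^ 1 + (- y) ^ 1 ≡ 0ℚ
    odd₁ = solve-∀ ℚ-ring
    odd₃ : ∀ y → y ^ 3 + (- y) ^ 3 ≡ 0ℚ
    odd₃ = solve-∀ ℚ-ring
    moments : ∀ {k} → k ℕ.≤ 3 → powerSum L k ≡ N * chebyshevMoment k
    moments {0} _ = ≡.trans (powerSum-length L) (sym (ℚP.*-identityʳ N))
    moments {1} _ = ≡.trans (powerSum-antipodalSet-odd 0 odd₁ withOrigin points) (sym (ℚP.*-zeroʳ N))
    moments {2} _ = ≡.trans (powerSum-antipodalSet-2 withOrigin points)
                            (4*S≡N⇒S+S≡N*½ (powerSum points 2) N (≡.trans squares (cong ℕtoℚ (sym size))))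
    moments {3} _ = ≡.trans (powerSum-antipodalSet-odd 2 odd₃ withOrigin points) (sym (ℚP.*-zeroʳ N))
    moments {suc (suc (suc (suc _)))} (ℕ.s≤s (ℕ.s≤s (ℕ.s≤s ())))

  SquaresIdentity : (m c : ℕ) → (Fin m → ℚ) → Set
  SquaresIdentity m c y = ℕtoℚ 4 * sumFin (λ i → y i ^ 2) ≡ ℕtoℚ c

  antipodalDesign⇒squaresIdentity : ∀ {n} → AntipodalDesign chebyshevMoment 3 n →
                                    Σ (Fin ⌊ n /2⌋ → ℚ) (SquaresIdentity ⌊ n /2⌋ n)
  antipodalDesign⇒squaresIdentity {n} design
    with L , length≡n , uniqueL , closed , equations ← antipodalDesign⇒list design
    with b , P , L↭ ← antipodal-decomposition L uniqueL closed
    = subst (λ k → Σ (Fin k → ℚ) (SquaresIdentity k n)) half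
            (lookup P , ≡.trans (cong (ℕtoℚ 4 *_) (sumFin-lookup (_^ 2) P))
                                (S+S≡N*½⇒4*S≡N (powerSum P 2) (ℕtoℚ n) doubled))
    where
    half : length P ≡ ⌊ n /2⌋
    half = ≡.trans (sym (⌊length/2⌋-antipodalSet b P)) (cong ⌊_/2⌋ (≡.trans (sym (↭-length L↭)) length≡n))
    doubled : powerSum P 2 + powerSum P 2 ≡ ℕtoℚ n * ½
    doubled = ≡.trans (sym (powerSum-antipodalSet-2 b P)) (≡.trans (sym (sumOver-↭ (_^ 2) L↭))
                (designEquations⇒powerSums {chebyshevMoment} {3} {ℕtoℚ n} L equations (ℕ.s≤s (ℕ.s≤s ℕ.z≤n))))

open ChebyshevDesigns


module RationalSquares where

  open import Data.Integer as ℤ using (+_; ∣_∣; sign; _◃_)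
  import Data.Integer.Properties as ℤP
  open import Data.Nat using (_+_; _*_; _≤_; _<_; _%_; _/_; s≤s; z≤n)
  open import Data.Nat.DivMod
    using (m%n<n; %-distribˡ-*; %-distribˡ-+; m%n%n≡m%n; m∣n⇒o%n%m≡o%m; m≡m%n+[m/n]*n; m<n⇒m%n≡m; m/n<m)
  open import Data.Nat.Divisibility using (divides)
  open import Data.Nat.Induction using (<-wellFounded)
  open import Data.Rational using (mkℚ)
  open import Data.Rational.Unnormalised as ℚᵘ using (*≡*)
  import Data.Rational.Unnormalised.Properties as ℚᵘP
  import Data.Sign as Sign
  open import Data.Sign.Properties using (s*s≡+)
  open import Induction.InfiniteDescent using (Descent; descent∧wf⇒empty)

  parity : ∀ n → n % 2 ≡ 0 ⊎ n % 2 ≡ 1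
  parity n with n % 2 | m%n<n n 2
  ... | 0           | _               = inj₁ refl
  ... | 1           | _               = inj₂ refl
  ... | suc (suc _) | s≤s (s≤s ())

  %2≤1 : ∀ x → x % 2 ≤ 1
  %2≤1 x = ℕ.s≤s⁻¹ (m%n<n x 2)

  even⇒half*2 : ∀ x → x % 2 ≡ 0 → x ≡ x / 2 * 2
  even⇒half*2 x even = ≡.trans (m≡m%n+[m/n]*n x 2) (cong (_+ x / 2 * 2) even)

  square%4 : ∀ x → x * x % 4 ≡ x % 2
  square%4 x = begin
    x * x % 4              ≡⟨ %-distribˡ-* x x 4 ⟩
    x % 4 * (x % 4) % 4    ≡⟨ residues (x % 4) (m%n<n x 4) ⟩
    x % 4 % 2              ≡⟨ m∣n⇒o%n%m≡o%m 2 4 x (divides 2 refl) ⟩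
    x % 2                  ∎
    where
    open ≡-Reasoning
    residues : ∀ r → r < 4 → r * r % 4 ≡ r % 2
    residues 0 _ = refl
    residues 1 _ = refl
    residues 2 _ = refl
    residues 3 _ = refl
    residues (suc (suc (suc (suc _)))) (s≤s (s≤s (s≤s (s≤s ()))))

  odd⇒square%8≡1 : ∀ x → x % 2 ≡ 1 → x * x % 8 ≡ 1
  odd⇒square%8≡1 x odd = begin
    x * x % 8              ≡⟨ %-distribˡ-* x x 8 ⟩
    x % 8 * (x % 8) % 8    ≡⟨ residues (x % 8) (m%n<n x 8) (≡.trans (m∣n⇒o%n%m≡o%m 2 8 x (divides 4 refl)) odd) ⟩
    1                      ∎
    where
    open ≡-Reasoning
    residues : ∀ r → r < 8 → r % 2 ≡ 1 → r * r % 8 ≡ 1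
    residues 1 _ _ = refl
    residues 3 _ _ = refl
    residues 5 _ _ = refl
    residues 7 _ _ = refl
    residues 0 _ ()
    residues 2 _ ()
    residues 4 _ ()
    residues 6 _ ()
    residues (suc (suc (suc (suc (suc (suc (suc (suc _))))))))
             (s≤s (s≤s (s≤s (s≤s (s≤s (s≤s (s≤s (s≤s ())))))))) _

  %-distribˡ-+₃ : ∀ a b c d .{{_ : NonZero d}} → (a + b + c) % d ≡ (a % d + b % d + c % d) % d
  %-distribˡ-+₃ a b c d = begin
    (a + b + c) % d                        ≡⟨ %-distribˡ-+ (a + b) c d ⟩
    ((a + b) % d + c % d) % d              ≡⟨ cong (λ s → (s + c % d) % d) (%-distribˡ-+ a b d) ⟩
    ((a % d + b % d) % d + c % d) % d      ≡⟨ cong (λ s → ((a % d + b % d) % d + s) % d) (m%n%n≡m%n c d) ⟨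
    ((a % d + b % d) % d + c % d % d) % d  ≡⟨ %-distribˡ-+ (a % d + b % d) (c % d) d ⟨
    (a % d + b % d + c % d) % d            ∎
    where open ≡-Reasoning

  *-square%4 : ∀ c w → c * (w * w) % 4 ≡ c % 4 * (w % 2) % 4
  *-square%4 c w = ≡.trans (%-distribˡ-* c (w * w) 4) (cong (λ r → c % 4 * r % 4) (square%4 w))

  square-parity : ∀ c x w → x * x ≡ c * (w * w) → x % 2 ≡ c % 4 * (w % 2) % 4
  square-parity c x w eq = ≡.trans (sym (square%4 x)) (≡.trans (cong (_% 4) eq) (*-square%4 c w))

  three-squares-parity : ∀ c x y z w → x * x + y * y + z * z ≡ c * (w * w) →
                         x % 2 + y % 2 + z % 2 ≡ c % 4 * (w % 2) % 4
  three-squares-parity c x y z w eq = begin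
    x % 2 + y % 2 + z % 2                      ≡⟨ m<n⇒m%n≡m bits<4 ⟨
    (x % 2 + y % 2 + z % 2) % 4                ≡⟨ cong₃ (square%4 x) (square%4 y) (square%4 z) ⟨
    (x * x % 4 + y * y % 4 + z * z % 4) % 4    ≡⟨ %-distribˡ-+₃ (x * x) (y * y) (z * z) 4 ⟨
    (x * x + y * y + z * z) % 4                ≡⟨ cong (_% 4) eq ⟩
    c * (w * w) % 4                            ≡⟨ *-square%4 c w ⟩
    c % 4 * (w % 2) % 4                        ∎
    where
    open ≡-Reasoning
    bits<4 : x % 2 + y % 2 + z % 2 < 4
    bits<4 = s≤s (ℕP.+-mono-≤ (ℕP.+-mono-≤ (%2≤1 x) (%2≤1 y)) (%2≤1 z))
    cong₃ : ∀ {a a′ b b′ e e′} → a ≡ a′ → b ≡ b′ → e ≡ e′ → (a + b + e) % 4 ≡ (a′ + b′ + e′) % 4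
    cong₃ refl refl refl = refl

  bits-sum≡3 : ∀ {a b e} → a ≤ 1 → b ≤ 1 → e ≤ 1 → a + b + e ≡ 3 → a ≡ 1 × b ≡ 1 × e ≡ 1
  bits-sum≡3 (s≤s z≤n) (s≤s z≤n) (s≤s z≤n) _  = refl , refl , refl
  bits-sum≡3 z≤n       z≤n       z≤n       ()
  bits-sum≡3 z≤n       z≤n       (s≤s z≤n) ()
  bits-sum≡3 z≤n       (s≤s z≤n) z≤n       ()
  bits-sum≡3 z≤n       (s≤s z≤n) (s≤s z≤n) ()
  bits-sum≡3 (s≤s z≤n) z≤n       z≤n       ()
  bits-sum≡3 (s≤s z≤n) z≤n       (s≤s z≤n) ()
  bits-sum≡3 (s≤s z≤n) (s≤s z≤n) z≤n       ()

  SquareSolution : ℕ → ℕ → Set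
  SquareSolution c w = NonZero w × ∃ λ x → x * x ≡ c * (w * w)

  ThreeSquaresSolution : ℕ → ℕ → Set
  ThreeSquaresSolution c w = NonZero w × ∃ λ x → ∃ λ y → ∃ λ z → x * x + y * y + z * z ≡ c * (w * w)

  even-nonZero⇒half : ∀ w .{{_ : NonZero w}} → w % 2 ≡ 0 → NonZero (w / 2) × w / 2 < w
  even-nonZero⇒half w even = ℕ.≢-nonZero half≢0 , m/n<m w 2 (s≤s (s≤s z≤n))
    where
    half≢0 : w / 2 ≢ 0
    half≢0 half≡0 = ℕ.≢-nonZero⁻¹ w (≡.trans (even⇒half*2 w even) (cong (_* 2) half≡0))

  halve-square : ∀ c {x w} x′ w′ → x ≡ x′ * 2 → w ≡ w′ * 2 →
                 x * x ≡ c * (w * w) → x′ * x′ ≡ c * (w′ * w′)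
  halve-square c x′ w′ refl refl eq =
    ℕP.*-cancelˡ-≡ (x′ * x′) (c * (w′ * w′)) 4 (≡.trans (expand x′) (≡.trans eq (expand′ c w′)))
    where
    expand : ∀ x → 4 * (x * x) ≡ x * 2 * (x * 2)
    expand = ℕ-Solver.solve-∀
    expand′ : ∀ c w → c * (w * 2 * (w * 2)) ≡ 4 * (c * (w * w))
    expand′ = ℕ-Solver.solve-∀

  halve-three-squares : ∀ c {x y z w} x′ y′ z′ w′ → x ≡ x′ * 2 → y ≡ y′ * 2 → z ≡ z′ * 2 → w ≡ w′ * 2 →
                        x * x + y * y + z * z ≡ c * (w * w) → x′ * x′ + y′ * y′ + z′ * z′ ≡ c * (w′ * w′)
  halve-three-squares c x′ y′ z′ w′ refl refl refl refl eq =
    ℕP.*-cancelˡ-≡ (x′ * x′ + y′ * y′ + z′ * z′) (c * (w′ * w′)) 4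
      (≡.trans (expand x′ y′ z′) (≡.trans eq (expand′ c w′)))
    where
    expand : ∀ x y z → 4 * (x * x + y * y + z * z) ≡ x * 2 * (x * 2) + y * 2 * (y * 2) + z * 2 * (z * 2)
    expand = ℕ-Solver.solve-∀
    expand′ : ∀ c w → c * (w * 2 * (w * 2)) ≡ 4 * (c * (w * w))
    expand′ = ℕ-Solver.solve-∀

  square-descent : ∀ c → 2 ≤ c % 4 → Descent _<_ (SquareSolution c)
  square-descent c 2≤c%4 {w} (w≢0 , x , eq) with parity w
  ... | inj₂ w-odd = ⊥-elim (ℕP.<⇒≱ (m%n<n x 2) (ℕP.≤-trans 2≤c%4 (ℕP.≤-reflexive (sym x%2≡c%4))))
    where
    x%2≡c%4 : x % 2 ≡ c % 4
    x%2≡c%4 = ≡.trans (square-parity c x w eq) (≡.trans (cong (λ r → c % 4 * r % 4) w-odd)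
                (≡.trans (cong (_% 4) (ℕP.*-identityʳ (c % 4))) (m%n%n≡m%n c 4)))
  ... | inj₁ w-even =
    w / 2 , proj₂ half , proj₁ half , x / 2 ,
    halve-square c (x / 2) (w / 2) (even⇒half*2 x x-even) (even⇒half*2 w w-even) eq
    where
    half = even-nonZero⇒half w {{w≢0}} w-even
    x-even : x % 2 ≡ 0
    x-even = ≡.trans (square-parity c x w eq)
               (≡.trans (cong (λ r → c % 4 * r % 4) w-even) (cong (_% 4) (ℕP.*-zeroʳ (c % 4))))

  three-squares-descent : ∀ c → c % 8 ≡ 7 → Descent _<_ (ThreeSquaresSolution c)
  three-squares-descent c c%8≡7 {w} (w≢0 , x , y , z , eq) with parity w
  ... | inj₂ w-odd = ⊥-elim (3≢7 (begin
      3                                          ≡⟨⟩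
      (1 + 1 + 1) % 8
        ≡⟨ cong₃ (odd⇒square%8≡1 x x-odd) (odd⇒square%8≡1 y y-odd) (odd⇒square%8≡1 z z-odd) ⟨
      (x * x % 8 + y * y % 8 + z * z % 8) % 8    ≡⟨ %-distribˡ-+₃ (x * x) (y * y) (z * z) 8 ⟨
      (x * x + y * y + z * z) % 8                ≡⟨ cong (_% 8) eq ⟩
      c * (w * w) % 8                            ≡⟨ %-distribˡ-* c (w * w) 8 ⟩
      c % 8 * (w * w % 8) % 8                    ≡⟨ cong₂ (λ r s → r * s % 8) c%8≡7 (odd⇒square%8≡1 w w-odd) ⟩
      7                                          ∎))
    where
    open ≡-Reasoning
    3≢7 : 3 ≢ 7
    3≢7 ()
    c%4≡3 : c % 4 ≡ 3
    c%4≡3 = ≡.trans (sym (m∣n⇒o%n%m≡o%m 4 8 c (divides 2 refl))) (cong (_% 4) c%8≡7)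
    odd-bits : x % 2 + y % 2 + z % 2 ≡ 3
    odd-bits = ≡.trans (three-squares-parity c x y z w eq) (≡.trans (cong (λ r → c % 4 * r % 4) w-odd)
                 (≡.trans (cong (_% 4) (ℕP.*-identityʳ (c % 4))) (≡.trans (m%n%n≡m%n c 4) c%4≡3)))
    all-odd = bits-sum≡3 (%2≤1 x) (%2≤1 y) (%2≤1 z) odd-bits
    x-odd = proj₁ all-odd
    y-odd = proj₁ (proj₂ all-odd)
    z-odd = proj₂ (proj₂ all-odd)
    cong₃ : ∀ {a a′ b b′ e e′} → a ≡ a′ → b ≡ b′ → e ≡ e′ → (a + b + e) % 8 ≡ (a′ + b′ + e′) % 8
    cong₃ refl refl refl = refl
  ... | inj₁ w-even = w / 2 , proj₂ half , proj₁ half , x / 2 , y / 2 , z / 2 ,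
      halve-three-squares c (x / 2) (y / 2) (z / 2) (w / 2)
        (even⇒half*2 x x-even) (even⇒half*2 y y-even) (even⇒half*2 z z-even) (even⇒half*2 w w-even) eq
    where
    half = even-nonZero⇒half w {{w≢0}} w-even
    even-bits : x % 2 + y % 2 + z % 2 ≡ 0
    even-bits = ≡.trans (three-squares-parity c x y z w eq)
                  (≡.trans (cong (λ r → c % 4 * r % 4) w-even) (cong (_% 4) (ℕP.*-zeroʳ (c % 4))))
    x-even = ℕP.m+n≡0⇒m≡0 (x % 2) (ℕP.m+n≡0⇒m≡0 (x % 2 + y % 2) even-bits)
    y-even = ℕP.m+n≡0⇒n≡0 (x % 2) (ℕP.m+n≡0⇒m≡0 (x % 2 + y % 2) even-bits)
    z-even = ℕP.m+n≡0⇒n≡0 (x % 2 + y % 2) even-bits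

  square-*-pos : ∀ i m → i ℤ.* i ℤ.* + m ≡ + (∣ i ∣ * ∣ i ∣ * m)
  square-*-pos i m = begin
    i ℤ.* i ℤ.* + m                     ≡⟨ cong (λ s → (s ◃ (∣ i ∣ * ∣ i ∣)) ℤ.* + m) (s*s≡+ (sign i)) ⟩
    (Sign.+ ◃ (∣ i ∣ * ∣ i ∣)) ℤ.* + m  ≡⟨ cong (ℤ._* + m) (ℤP.+◃n≡+n (∣ i ∣ * ∣ i ∣)) ⟩
    + (∣ i ∣ * ∣ i ∣) ℤ.* + m           ≡⟨ ℤP.pos-* (∣ i ∣ * ∣ i ∣) m ⟨
    + (∣ i ∣ * ∣ i ∣ * m)               ∎
    where open ≡-Reasoning

  rational-square⇒solution : ∀ a c → a ℚ.* a ≡ ℕtoℚ c → ∃ (SquareSolution c)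
  rational-square⇒solution a@(mkℚ p d _) c a²≡c
    with *≡* eq ← ℚᵘP.≃-trans (ℚᵘP.≃-sym (ℚP.toℚᵘ-homo-* a a))
                               (ℚᵘP.≃-trans (ℚP.toℚᵘ-cong a²≡c) (toℚᵘ-/ c 0))
    = suc d , _ , ∣ p ∣ , ℤP.+-injective (begin
      + (∣ p ∣ * ∣ p ∣)             ≡⟨ cong +_ (ℕP.*-identityʳ _) ⟨
      + (∣ p ∣ * ∣ p ∣ * 1)         ≡⟨ square-*-pos p 1 ⟨
      p ℤ.* p ℤ.* + 1              ≡⟨ eq ⟩
      + c ℤ.* + (suc d * suc d)    ≡⟨ ℤP.pos-* c (suc d * suc d) ⟨
      + (c * (suc d * suc d))      ∎)
    where open ≡-Reasoning

  toℚᵘ-three-squares : ∀ a b e → toℚᵘ (a ℚ.* a ℚ.+ b ℚ.* b ℚ.+ e ℚ.* e) ℚᵘ.≃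
                       toℚᵘ a ℚᵘ.* toℚᵘ a ℚᵘ.+ toℚᵘ b ℚᵘ.* toℚᵘ b ℚᵘ.+ toℚᵘ e ℚᵘ.* toℚᵘ e
  toℚᵘ-three-squares a b e = ℚᵘP.≃-trans (ℚP.toℚᵘ-homo-+ (a ℚ.* a ℚ.+ b ℚ.* b) (e ℚ.* e))
    (ℚᵘP.+-cong (ℚᵘP.≃-trans (ℚP.toℚᵘ-homo-+ (a ℚ.* a) (b ℚ.* b))
                             (ℚᵘP.+-cong (ℚP.toℚᵘ-homo-* a a) (ℚP.toℚᵘ-homo-* b b)))
                (ℚP.toℚᵘ-homo-* e e))

  three-squares-*-pos : ∀ p q r A B C →
    ((p ℤ.* p ℤ.* + B ℤ.+ q ℤ.* q ℤ.* + A) ℤ.* + C ℤ.+ r ℤ.* r ℤ.* + (A * B)) ℤ.* + 1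
      ≡ + (((∣ p ∣ * ∣ p ∣ * B + ∣ q ∣ * ∣ q ∣ * A) * C + ∣ r ∣ * ∣ r ∣ * (A * B)) * 1)
  three-squares-*-pos p q r A B C = begin
    ((p ℤ.* p ℤ.* + B ℤ.+ q ℤ.* q ℤ.* + A) ℤ.* + C ℤ.+ r ℤ.* r ℤ.* + (A * B)) ℤ.* + 1
      ≡⟨ cong (λ u → (u ℤ.* + C ℤ.+ r ℤ.* r ℤ.* + (A * B)) ℤ.* + 1)
              (cong₂ ℤ._+_ (square-*-pos p B) (square-*-pos q A)) ⟩
    (+ (P * B + Q * A) ℤ.* + C ℤ.+ r ℤ.* r ℤ.* + (A * B)) ℤ.* + 1
      ≡⟨ cong₂ (λ u v → (u ℤ.+ v) ℤ.* + 1) (sym (ℤP.pos-* (P * B + Q * A) C)) (square-*-pos r (A * B)) ⟩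
    + ((P * B + Q * A) * C + R * (A * B)) ℤ.* + 1
      ≡⟨ ℤP.pos-* ((P * B + Q * A) * C + R * (A * B)) 1 ⟨
    + (((P * B + Q * A) * C + R * (A * B)) * 1)  ∎
    where
    open ≡-Reasoning
    P = ∣ p ∣ * ∣ p ∣
    Q = ∣ q ∣ * ∣ q ∣
    R = ∣ r ∣ * ∣ r ∣

  rational-three-squares⇒solution : ∀ a b e c → a ℚ.* a ℚ.+ b ℚ.* b ℚ.+ e ℚ.* e ≡ ℕtoℚ c →
                                    ∃ (ThreeSquaresSolution c)
  rational-three-squares⇒solution a@(mkℚ pa da _) b@(mkℚ pb db _) e@(mkℚ pe de _) c sum≡c
    with *≡* eq ← ℚᵘP.≃-trans (ℚᵘP.≃-sym (toℚᵘ-three-squares a b e))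
                               (ℚᵘP.≃-trans (ℚP.toℚᵘ-cong sum≡c) (toℚᵘ-/ c 0))
    = W , _ , X , Y , Z , ℤP.+-injective (begin
      + (X * X + Y * Y + Z * Z)
        ≡⟨ cong +_ (expand (∣ pa ∣) (∣ pb ∣) (∣ pe ∣) Da Db De) ⟩
      + (((∣ pa ∣ * ∣ pa ∣ * B + ∣ pb ∣ * ∣ pb ∣ * A) * C + ∣ pe ∣ * ∣ pe ∣ * (A * B)) * 1)
        ≡⟨ three-squares-*-pos pa pb pe A B C ⟨
      ((pa ℤ.* pa ℤ.* + B ℤ.+ pb ℤ.* pb ℤ.* + A) ℤ.* + C ℤ.+ pe ℤ.* pe ℤ.* + (A * B)) ℤ.* + 1
        ≡⟨ eq ⟩
      + c ℤ.* + (A * B * C)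
        ≡⟨ ℤP.pos-* c (A * B * C) ⟨
      + (c * (A * B * C))
        ≡⟨ cong +_ (regroup c Da Db De) ⟩
      + (c * (W * W))  ∎)
    where
    open ≡-Reasoning
    Da = suc da
    Db = suc db
    De = suc de
    A = Da * Da
    B = Db * Db
    C = De * De
    X = ∣ pa ∣ * Db * De
    Y = ∣ pb ∣ * Da * De
    Z = ∣ pe ∣ * Da * Db
    W = Da * Db * De
    expand : ∀ p q r u v w → p * v * w * (p * v * w) + q * u * w * (q * u * w) + r * u * v * (r * u * v)
                           ≡ ((p * p * (v * v) + q * q * (u * u)) * (w * w) + r * r * (u * u * (v * v))) * 1
    expand = ℕ-Solver.solve-∀
    regroup : ∀ c u v w → c * (u * u * (v * v) * (w * w)) ≡ c * (u * v * w * (u * v * w))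
    regroup = ℕ-Solver.solve-∀

  ¬rational-square : ∀ c → 2 ≤ c % 4 → ∀ a → a ℚ.* a ≢ ℕtoℚ c
  ¬rational-square c 2≤c%4 a a²≡c with w , solution ← rational-square⇒solution a c a²≡c =
    descent∧wf⇒empty (square-descent c 2≤c%4) <-wellFounded w solution

  ¬rational-three-squares : ∀ c → c % 8 ≡ 7 → ∀ a b e → a ℚ.* a ℚ.+ b ℚ.* b ℚ.+ e ℚ.* e ≢ ℕtoℚ c
  ¬rational-three-squares c c%8≡7 a b e sum≡c with w , solution ← rational-three-squares⇒solution a b e c sum≡c =
    descent∧wf⇒empty (three-squares-descent c c%8≡7) <-wellFounded w solution

  ¬squaresIdentity₀ : (y : Fin 0 → ℚ) → ¬ SquaresIdentity 0 1 y
  ¬squaresIdentity₀ y ()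

  ¬squaresIdentity₁ : ∀ c → 2 ≤ c % 4 → (y : Fin 1 → ℚ) → ¬ SquaresIdentity 1 c y
  ¬squaresIdentity₁ c 2≤c%4 y squares =
    ¬rational-square c 2≤c%4 (y₀ ℚ.+ y₀) (≡.trans (doubled y₀) squares)
    where
    y₀ = y zero
    doubled : ∀ a → (a ℚ.+ a) ℚ.* (a ℚ.+ a) ≡ ℕtoℚ 4 ℚ.* (a ^ 2 ℚ.+ 0ℚ)
    doubled = solve-∀ ℚ-ring

  ¬squaresIdentity₃ : ∀ c → c % 8 ≡ 7 → (y : Fin 3 → ℚ) → ¬ SquaresIdentity 3 c y
  ¬squaresIdentity₃ c c%8≡7 y squares =
    ¬rational-three-squares c c%8≡7 (y₀ ℚ.+ y₀) (y₁ ℚ.+ y₁) (y₂ ℚ.+ y₂)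
      (≡.trans (doubled y₀ y₁ y₂) squares)
    where
    y₀ = y zero
    y₁ = y (suc zero)
    y₂ = y (suc (suc zero))
    doubled : ∀ a b e → (a ℚ.+ a) ℚ.* (a ℚ.+ a) ℚ.+ (b ℚ.+ b) ℚ.* (b ℚ.+ b) ℚ.+ (e ℚ.+ e) ℚ.* (e ℚ.+ e)
                      ≡ ℕtoℚ 4 ℚ.* (a ^ 2 ℚ.+ (b ^ 2 ℚ.+ (e ^ 2 ℚ.+ 0ℚ)))
    doubled = solve-∀ ℚ-ring

open RationalSquares


Exceptional : ℕ → Set
Exceptional n = n ≡ 1 ⊎ n ≡ 2 ⊎ n ≡ 3 ⊎ n ≡ 7


module PythagoreanPairs where

  open import Data.Integer using (+_)
  open import Data.List.Relation.Unary.All using (all?)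
  open import Data.List.Relation.Unary.Unique.DecPropositional ℚP._≟_ using (unique?)
  open import Data.Nat using (_+_; _*_; _<_)
  open import Data.Rational using (_/_)
  open import Relation.Nullary.Decidable using (True; toWitness; _×-dec_)

  m+[1+k]≡n⇒m<n : ∀ m k {n} → m + suc k ≡ n → m < n
  m+[1+k]≡n⇒m<n m k refl = ℕP.m<m+n m ℕ.z<s

  -- The triple (2t, t² − 1, t² + 1) for t = j + 4, with t² − 1 = (j + 3)(j + 5) to avoid
  -- truncated subtraction; j = 0 gives 8/17 and 15/17.
  leg₁ leg₂ : ℕ → ℚ
  leg₁ j = + (2 * (j + 4)) / suc ((j + 4) * (j + 4))
  leg₂ j = + ((j + 3) * (j + 5)) / suc ((j + 4) * (j + 4))

  legs-pythagorean : ∀ j → leg₁ j ^ 2 ℚ.+ leg₂ j ^ 2 ≡ 1ℚ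
  legs-pythagorean j = /-pythagorean (2 * (j + 4)) ((j + 3) * (j + 5)) ((j + 4) * (j + 4)) (triple j)
    where
    triple : ∀ j → 2 * (j + 4) * (2 * (j + 4)) + (j + 3) * (j + 5) * ((j + 3) * (j + 5))
                 ≡ suc ((j + 4) * (j + 4)) * suc ((j + 4) * (j + 4))
    triple = ℕ-Solver.solve-∀

  leg₁-decreasing : ∀ j → leg₁ (suc j) ℚ.< leg₁ j
  leg₁-decreasing j = /-<-/ (2 * (suc j + 4)) ((suc j + 4) * (suc j + 4)) (2 * (j + 4)) ((j + 4) * (j + 4))
    (m+[1+k]≡n⇒m<n _ (2 * j * j + 18 * j + 37) (gap j))
    where
    gap : ∀ j → 2 * (suc j + 4) * suc ((j + 4) * (j + 4)) + suc (2 * j * j + 18 * j + 37)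
              ≡ 2 * (j + 4) * suc ((suc j + 4) * (suc j + 4))
    gap = ℕ-Solver.solve-∀

  leg₂-increasing : ∀ j → leg₂ j ℚ.< leg₂ (suc j)
  leg₂-increasing j = /-<-/ ((j + 3) * (j + 5)) ((j + 4) * (j + 4)) ((suc j + 3) * (suc j + 5)) ((suc j + 4) * (suc j + 4))
    (m+[1+k]≡n⇒m<n _ (4 * j + 17) (gap j))
    where
    gap : ∀ j → (j + 3) * (j + 5) * suc ((suc j + 4) * (suc j + 4)) + suc (4 * j + 17)
              ≡ (suc j + 3) * (suc j + 5) * suc ((j + 4) * (j + 4))
    gap = ℕ-Solver.solve-∀

  leg₁<leg₂ : ∀ j → leg₁ j ℚ.< leg₂ j
  leg₁<leg₂ j = /-<-/ (2 * (j + 4)) ((j + 4) * (j + 4)) ((j + 3) * (j + 5)) ((j + 4) * (j + 4))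
    (ℕP.*-monoˡ-< (suc ((j + 4) * (j + 4))) (m+[1+k]≡n⇒m<n _ (j * j + 6 * j + 6) (gap j)))
    where
    gap : ∀ j → 2 * (j + 4) + suc (j * j + 6 * j + 6) ≡ (j + 3) * (j + 5)
    gap = ℕ-Solver.solve-∀

  0<leg₁ : ∀ j → 0ℚ ℚ.< leg₁ j
  0<leg₁ j = /-<-/ 0 0 (2 * (j + 4)) ((j + 4) * (j + 4)) (m+[1+k]≡n⇒m<n 0 (2 * j + 7) (gap j))
    where
    gap : ∀ j → suc (2 * j + 7) ≡ 2 * (j + 4) * 1
    gap = ℕ-Solver.solve-∀

  leg₂<1 : ∀ j → leg₂ j ℚ.< 1ℚ
  leg₂<1 j = /-<-/ ((j + 3) * (j + 5)) ((j + 4) * (j + 4)) 1 0 (m+[1+k]≡n⇒m<n _ 1 (gap j))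
    where
    gap : ∀ j → (j + 3) * (j + 5) * 1 + 2 ≡ 1 * suc ((j + 4) * (j + 4))
    gap = ℕ-Solver.solve-∀

  between-legs-suc : ∀ k {y} → leg₁ k ℚ.< y × y ℚ.< leg₂ k → leg₁ (suc k) ℚ.< y × y ℚ.< leg₂ (suc k)
  between-legs-suc k (lo<y , y<hi) = ℚP.<-trans (leg₁-decreasing k) lo<y , ℚP.<-trans y<hi (leg₂-increasing k)

  addPairs : ∀ k {n} → PositiveHalf (leg₁ 0) (leg₂ 0) n → PositiveHalf (leg₁ k) (leg₂ k) (k * 4 + n)
  addPairs zero        h = h
  addPairs (suc k) {n} h = record
    { withOrigin = withOrigin
    ; points     = leg₁ k ∷ leg₂ k ∷ points
    ; unique     = (ℚP.<⇒≢ (leg₁<leg₂ k) ∷ All.map leg₁≢ inside) ∷ All.map leg₂≢ inside ∷ unique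
    ; inside     = (leg₁-decreasing k , ℚP.<-trans (leg₁<leg₂ k) (leg₂-increasing k))
                 ∷ (ℚP.<-trans (leg₁-decreasing k) (leg₁<leg₂ k) , leg₂-increasing k)
                 ∷ All.map (between-legs-suc k) inside
    ; size       = cong (λ m → 4 + m) size
    ; squares    = begin
        ℕtoℚ 4 ℚ.* (leg₁ k ^ 2 ℚ.+ (leg₂ k ^ 2 ℚ.+ powerSum points 2))
          ≡⟨ distribute (ℕtoℚ 4) (leg₁ k ^ 2) (leg₂ k ^ 2) (powerSum points 2) ⟩
        ℕtoℚ 4 ℚ.* (leg₁ k ^ 2 ℚ.+ leg₂ k ^ 2) ℚ.+ ℕtoℚ 4 ℚ.* powerSum points 2
          ≡⟨ cong₂ (λ p q → ℕtoℚ 4 ℚ.* p ℚ.+ q) (legs-pythagorean k) squares ⟩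
        ℕtoℚ 4 ℚ.* 1ℚ ℚ.+ ℕtoℚ (k * 4 + n)
          ≡⟨ cong (ℚ._+ ℕtoℚ (k * 4 + n)) (ℚP.*-identityʳ (ℕtoℚ 4)) ⟩
        ℕtoℚ 4 ℚ.+ ℕtoℚ (k * 4 + n)
          ≡⟨ ℕtoℚ-+ 4 (k * 4 + n) ⟨
        ℕtoℚ (4 + (k * 4 + n))
          ≡⟨ cong ℕtoℚ unfold ⟩
        ℕtoℚ (suc k * 4 + n)  ∎
    }
    where
    open PositiveHalf (addPairs k h)
    open ≡-Reasoning
    leg₁≢ : ∀ {y} → leg₁ k ℚ.< y × y ℚ.< leg₂ k → leg₁ k ≢ y
    leg₁≢ (lo<y , _) = ℚP.<⇒≢ lo<y
    leg₂≢ : ∀ {y} → leg₁ k ℚ.< y × y ℚ.< leg₂ k → leg₂ k ≢ y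
    leg₂≢ (_ , y<hi) = ≢-sym (ℚP.<⇒≢ y<hi)
    distribute : ∀ c p q s → c ℚ.* (p ℚ.+ (q ℚ.+ s)) ≡ c ℚ.* (p ℚ.+ q) ℚ.+ c ℚ.* s
    distribute = solve-∀ ℚ-ring
    -- A separate step: unifying the two sides under ℕtoℚ would unfold its gcd normalisation.
    unfold : 4 + (k * 4 + n) ≡ suc k * 4 + n
    unfold = refl

  PositiveHalf-widen : ∀ {lo hi lo′ hi′ n} → lo′ ℚ.≤ lo → hi ℚ.≤ hi′ →
                       PositiveHalf lo hi n → PositiveHalf lo′ hi′ n
  PositiveHalf-widen lo′≤lo hi≤hi′ h = record
    { withOrigin = withOrigin ; points = points ; unique = unique
    ; inside = All.map (λ (lo<y , y<hi) → ℚP.≤-<-trans lo′≤lo lo<y , ℚP.<-≤-trans y<hi hi≤hi′) inside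
    ; size = size ; squares = squares }
    where open PositiveHalf h

  Seed : ℕ → Set
  Seed = PositiveHalf (leg₁ 0) (leg₂ 0)

  mkSeed : ∀ withOrigin points {n} {_ : True (unique? points)}
           {_ : True (all? (λ y → leg₁ 0 ℚP.<? y ×-dec y ℚP.<? leg₂ 0) points)} →
           length (antipodalSet withOrigin points) ≡ n → ℕtoℚ 4 ℚ.* powerSum points 2 ≡ ℕtoℚ n → Seed n
  mkSeed withOrigin points {_} {unique} {inside} size squares = record
    { withOrigin = withOrigin ; points = points ; unique = toWitness unique ; inside = toWitness inside
    ; size = size ; squares = squares }

  seed₀ : Seed 0
  seed₀ = mkSeed false [] refl refl

  seed₅ : Seed 5
  seed₅ = mkSeed true (+ 11 / 13 ∷ + 19 / 26 ∷ []) refl refl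

  seed₆ : Seed 6
  seed₆ = mkSeed false (+ 11 / 18 ∷ + 13 / 18 ∷ + 7 / 9 ∷ []) refl refl

  seed₁₁ : Seed 11
  seed₁₁ = mkSeed true (+ 9 / 14 ∷ + 2 / 3 ∷ + 16 / 21 ∷ + 11 / 14 ∷ + 5 / 6 ∷ []) refl refl

  seed-split : ∀ n → ¬ Exceptional n → ∃₂ λ k s → n ≡ k * 4 + s × Seed s
  seed-split 0  _  = 0 , 0 , refl , seed₀
  seed-split 1  ¬e = ⊥-elim (¬e (inj₁ refl))
  seed-split 2  ¬e = ⊥-elim (¬e (inj₂ (inj₁ refl)))
  seed-split 3  ¬e = ⊥-elim (¬e (inj₂ (inj₂ (inj₁ refl))))
  seed-split 4  _  = 1 , 0 , refl , seed₀
  seed-split 5  _  = 0 , 5 , refl , seed₅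
  seed-split 6  _  = 0 , 6 , refl , seed₆
  seed-split 7  ¬e = ⊥-elim (¬e (inj₂ (inj₂ (inj₂ refl))))
  seed-split 8  _  = 2 , 0 , refl , seed₀
  seed-split 9  _  = 1 , 5 , refl , seed₅
  seed-split 10 _  = 1 , 6 , refl , seed₆
  seed-split 11 _  = 0 , 11 , refl , seed₁₁
  seed-split (suc (suc (suc (suc n@(suc (suc (suc (suc (suc (suc (suc (suc _)))))))))))) _
    with k , s , n≡k*4+s , seed ← seed-split n
           (λ { (inj₁ ()) ; (inj₂ (inj₁ ())) ; (inj₂ (inj₂ (inj₁ ()))) ; (inj₂ (inj₂ (inj₂ ()))) })
    = suc k , s , cong (λ m → 4 + m) n≡k*4+s , seed

  antipodalDesign-exists : ∀ n → ¬ Exceptional n → AntipodalDesign chebyshevMoment 3 n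
  antipodalDesign-exists n ¬e with k , s , refl , seed ← seed-split n ¬e =
    positiveHalf⇒antipodalDesign {k * 4 + s}
      (PositiveHalf-widen (ℚP.<⇒≤ (0<leg₁ k)) (ℚP.<⇒≤ (leg₂<1 k)) (addPairs k seed))

open PythagoreanPairs


no-antipodalDesign : ∀ {n} → Exceptional n → ¬ AntipodalDesign chebyshevMoment 3 n
no-antipodalDesign (inj₁ refl)               design =
  uncurry ¬squaresIdentity₀ (antipodalDesign⇒squaresIdentity {1} design)
no-antipodalDesign (inj₂ (inj₁ refl))        design =
  uncurry (¬squaresIdentity₁ 2 ℕP.≤-refl) (antipodalDesign⇒squaresIdentity {2} design)
no-antipodalDesign (inj₂ (inj₂ (inj₁ refl))) design =
  uncurry (¬squaresIdentity₁ 3 (ℕ.s≤s (ℕ.s≤s ℕ.z≤n))) (antipodalDesign⇒squaresIdentity {3} design)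
no-antipodalDesign (inj₂ (inj₂ (inj₂ refl))) design =
  uncurry (¬squaresIdentity₃ 7 refl) (antipodalDesign⇒squaresIdentity {7} design)

corollary3p4 : (n : ℕ) → .{{_ : NonZero n}} →
    (Σ (Fin n → ℚ) (λ x → IsDesign chebyshevMoment 3 n x × IsAntipodal x))
      ⇔ (¬ (n ≡ 1 ⊎ n ≡ 2 ⊎ n ≡ 3 ⊎ n ≡ 7))
corollary3p4 n = mk⇔ (λ design exceptional → no-antipodalDesign {n} exceptional design) (antipodalDesign-exists n)
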